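{- Let $G$ and $H$ be finite simple graphs. Then $(G\square H)_\delta=G_\delta\square H_\delta$ if and only if for all $u=(u_1,u_2)$ and $v=(v_1,v_2)$ in $V(G)\times V(H)$ with $u_1\neq v_1$ and $u_2\neq v_2$, we have $d_{G\square H}(u)\neq d_{G\square H}(v)$.
   Context: All graphs are finite and simple; $d_G(x)$ denotes the degree of $x$ in $G$. The $\delta$-complement $G_\delta$ of a graph $G$ is the graph on $V(G)$ in which distinct $u,v$ are adjacent iff either ($d_G(u)=d_G(v)$ and $uv\notin E(G)$) or ($d_G(u)\neq d_G(v)$ and $uv\in E(G)$). The Cartesian product $G\square H$ has vertex set $V(G)\times V(H)$, with $(x,y)$ adjacent to $(x',y')$ iff either $x=x'$ and $yy'\in E(H)$, or $y=y'$ and $xx'\in E(G)$. -}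

module Defs where

open import Data.Nat using (ℕ)
open import Data.Bool using (Bool; true; false; _∧_; _∨_; not) renaming (_≟_ to _≟ᵇ_)
open import Data.Fin using (Fin)
open import Data.Fin.Properties using () renaming (_≟_ to _≟ᶠ_)
open import Data.List using (List; filter; length; allFin; cartesianProduct)
open import Data.Product using (_×_; _,_)
open import Relation.Binary.PropositionalEquality using (_≡_)
open import Relation.Nullary.Decidable using (⌊_⌋)
open import Data.Nat.Properties using () renaming (_≟_ to _≟ℕ_)

record Graph (n : ℕ) : Set where
  field
    adj   : Fin n → Fin n → Bool
    sym   : ∀ u v → adj u v ≡ adj v u
    irref : ∀ u → adj u u ≡ false
open Graph public

degree : {V : Set} → List V → (V → V → Bool) → V → ℕ
degree vs a x = length (filter (λ y → a x y ≟ᵇ true) vs)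

δadj : {V : Set} → (V → V → Bool) → List V → (V → V → Bool) → V → V → Bool
δadj eq vs a u v =
  not (eq u v) ∧
    ( (⌊ degree vs a u ≟ℕ degree vs a v ⌋ ∧ not (a u v))
    ∨ (not ⌊ degree vs a u ≟ℕ degree vs a v ⌋ ∧ a u v) )

□adj : ∀ {n m} → (Fin n → Fin n → Bool) → (Fin m → Fin m → Bool)
     → Fin n × Fin m → Fin n × Fin m → Bool
□adj a b (x , y) (x' , y') =
  (⌊ x ≟ᶠ x' ⌋ ∧ b y y') ∨ (⌊ y ≟ᶠ y' ⌋ ∧ a x x')

eqFin : ∀ {n} → Fin n → Fin n → Bool
eqFin x y = ⌊ x ≟ᶠ y ⌋

eqPair : ∀ {n m} → Fin n × Fin m → Fin n × Fin m → Bool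
eqPair (x , y) (x' , y') = eqFin x x' ∧ eqFin y y'

allPairs : ∀ n m → List (Fin n × Fin m)
allPairs n m = cartesianProduct (allFin n) (allFin m)

prodAdj : ∀ {n m} → Graph n → Graph m → Fin n × Fin m → Fin n × Fin m → Bool
prodAdj G H = □adj (adj G) (adj H)

prodDeg : ∀ {n m} → Graph n → Graph m → Fin n × Fin m → ℕ
prodDeg {n} {m} G H = degree (allPairs n m) (prodAdj G H)

δGraphAdj : ∀ {n} → Graph n → Fin n → Fin n → Bool
δGraphAdj {n} G = δadj eqFin (allFin n) (adj G)

δProdAdj : ∀ {n m} → Graph n → Graph m → Fin n × Fin m → Fin n × Fin m → Bool
δProdAdj {n} {m} G H = δadj eqPair (allPairs n m) (prodAdj G H)

δProdEq : ∀ {n m} → Graph n → Graph m → Set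
δProdEq G H = ∀ u v → δProdAdj G H u v ≡ □adj (δGraphAdj G) (δGraphAdj H) u v

-- Degrees in G □ H add, d(x , y) = d_G(x) + d_H(y), because the neighbourhood of (x , y) is the
-- disjoint union of {x} × N_H(y) and N_G(x) × {y}.  So for two vertices sharing a coordinate the
-- degree test of the δ-complement in G □ H is the degree test in the other factor, and (G □ H)_δ
-- agrees with G_δ □ H_δ on such pairs.  On a pair differing in both coordinates neither G □ H nor
-- G_δ □ H_δ has an edge, so (G □ H)_δ has one there exactly when the two degrees are equal.
module Submission where

open import Defs hiding (sym)
open import Data.Bool using (Bool; true; false; _∧_; _∨_) renaming (_≟_ to _≟ᵇ_)
open import Data.Bool.Properties using (∧-zeroʳ; ∧-identityʳ; ∨-identityʳ)
open import Data.Fin using (Fin; zero; suc)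
open import Data.Fin.Properties using (suc-injective) renaming (_≟_ to _≟ᶠ_)
open import Data.List using (List; []; _∷_; [_]; _++_; map; filter; length; allFin; cartesianProduct)
open import Data.List.Properties using (filter-++; length-++; map-tabulate)
open import Data.Nat using (ℕ; suc; _+_; _*_)
open import Data.Nat.Properties using (+-identityʳ; +-cancelʳ-≡; +-cancelˡ-≡) renaming (_≟_ to _≟ℕ_)
open import Data.Nat.Solver using (module +-*-Solver)
open import Data.Product using (_×_; _,_; proj₁; proj₂)
open import Function.Base using (_∘_; id)
open import Function.Bundles using (_⇔_; mk⇔)
open import Relation.Binary.PropositionalEquality
  using (_≡_; _≢_; refl; sym; trans; cong; cong₂; module ≡-Reasoning)
open import Relation.Nullary.Negation using (¬_)
open import Relation.Nullary.Decidable
  using (Dec; yes; no; ⌊_⌋; isYes≗does; dec-true; dec-false; does-⇔; ⌊⌋-map′)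

open +-*-Solver using (solve; _:+_; _:*_; _:=_; con)
open ≡-Reasoning

private
  variable
    A B : Set

count : (A → Bool) → List A → ℕ
count p xs = length (filter (λ z → p z ≟ᵇ true) xs)

count-++ : (p : A → Bool) (xs ys : List A) → count p (xs ++ ys) ≡ count p xs + count p ys
count-++ p xs ys = trans (cong length (filter-++ (λ z → p z ≟ᵇ true) xs ys)) (length-++ (filter _ xs))

count-map : (p : B → Bool) (f : A → B) (xs : List A) → count p (map f xs) ≡ count (p ∘ f) xs
count-map p f [] = refl
count-map p f (x ∷ xs) with p (f x)
... | true  = cong suc (count-map p f xs)
... | false = count-map p f xs

count-cong : {p q : A → Bool} → (∀ z → p z ≡ q z) → (xs : List A) → count p xs ≡ count q xs
count-cong p≗q [] = refl
count-cong {p = p} {q} p≗q (x ∷ xs) with p x | q x | p≗q x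
... | true  | true  | refl = cong suc (count-cong p≗q xs)
... | false | false | refl = count-cong p≗q xs

count-false : (xs : List A) → count (λ _ → false) xs ≡ 0
count-false [] = refl
count-false (x ∷ xs) = count-false xs

eqFin-suc : ∀ {k} (x y : Fin k) → eqFin (suc x) (suc y) ≡ eqFin x y
eqFin-suc x y = ⌊⌋-map′ (cong suc) suc-injective (x ≟ᶠ y)

count-eqFin-allFin : ∀ {k} (x : Fin k) → count (eqFin x) (allFin k) ≡ 1
count-eqFin-allFin {suc k} x =
  trans (cong (count (eqFin x) ∘ (zero ∷_)) (sym (map-tabulate id suc))) (count-zero∷map-suc x)
  where
  count-zero∷map-suc : ∀ x → count (eqFin x) (zero ∷ map suc (allFin k)) ≡ 1
  count-zero∷map-suc zero    = cong suc (trans (count-map (eqFin zero) suc (allFin k)) (count-false (allFin k)))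
  count-zero∷map-suc (suc x) = begin
    count (eqFin (suc x)) (map suc (allFin k)) ≡⟨ count-map (eqFin (suc x)) suc (allFin k) ⟩
    count (eqFin (suc x) ∘ suc) (allFin k)     ≡⟨ count-cong (eqFin-suc x) (allFin k) ⟩
    count (eqFin x) (allFin k)                 ≡⟨ count-eqFin-allFin x ⟩
    1                                          ∎

-- With e = (x ≡_), p = N_H(y), q = (y ≡_), c = N_G(x) this is the neighbourhood of (x , y) in G □ H.
module _ (e c : A → Bool) (p q : B → Bool) (e∧c≡false : ∀ x → e x ∧ c x ≡ false) where

  twoRectangles : A × B → Bool
  twoRectangles w = (e (proj₁ w) ∧ p (proj₂ w)) ∨ (q (proj₂ w) ∧ c (proj₁ w))

  count-twoRectangles-row : (x : A) (ys : List B) →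
    count twoRectangles (map (x ,_) ys) ≡ count e [ x ] * count p ys + count c [ x ] * count q ys
  count-twoRectangles-row x ys rewrite count-map twoRectangles (x ,_) ys with e x | c x | e∧c≡false x
  ... | true  | false | refl = begin
    count (λ y → p y ∨ (q y ∧ false)) ys
      ≡⟨ count-cong (λ y → trans (cong (p y ∨_) (∧-zeroʳ (q y))) (∨-identityʳ (p y))) ys ⟩
    count p ys                           ≡⟨ sym (trans (+-identityʳ _) (+-identityʳ _)) ⟩
    1 * count p ys + 0 * count q ys      ∎
  ... | false | true  | refl = begin
    count (λ y → q y ∧ true) ys     ≡⟨ count-cong (∧-identityʳ ∘ q) ys ⟩
    count q ys                      ≡⟨ sym (+-identityʳ _) ⟩
    0 * count p ys + 1 * count q ys ∎
  ... | false | false | refl = trans (count-cong (∧-zeroʳ ∘ q) ys) (count-false ys)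

  count-twoRectangles : (xs : List A) (ys : List B) →
    count twoRectangles (cartesianProduct xs ys) ≡ count e xs * count p ys + count c xs * count q ys
  count-twoRectangles []       ys = refl
  count-twoRectangles (x ∷ xs) ys = begin
    count twoRectangles (map (x ,_) ys ++ cartesianProduct xs ys)
      ≡⟨ count-++ twoRectangles (map (x ,_) ys) _ ⟩
    count twoRectangles (map (x ,_) ys) + count twoRectangles (cartesianProduct xs ys)
      ≡⟨ cong₂ _+_ (count-twoRectangles-row x ys) (count-twoRectangles xs ys) ⟩
    (count e [ x ] * P + count c [ x ] * Q) + (count e xs * P + count c xs * Q)
      ≡⟨ solve 6 (λ e₁ c₁ e c p q →
                    (e₁ :* p :+ c₁ :* q) :+ (e :* p :+ c :* q) := (e₁ :+ e) :* p :+ (c₁ :+ c) :* q)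
               refl (count e [ x ]) (count c [ x ]) (count e xs) (count c xs) P Q ⟩
    (count e [ x ] + count e xs) * P + (count c [ x ] + count c xs) * Q
      ≡⟨ sym (cong₂ (λ s t → s * P + t * Q) (count-++ e [ x ] xs) (count-++ c [ x ] xs)) ⟩
    count e (x ∷ xs) * P + count c (x ∷ xs) * Q ∎
    where
    P = count p ys
    Q = count q ys

isYes-⇔ : {P Q : Set} → P ⇔ Q → (p? : Dec P) (q? : Dec Q) → ⌊ p? ⌋ ≡ ⌊ q? ⌋
isYes-⇔ P⇔Q p? q? = trans (isYes≗does p?) (trans (does-⇔ P⇔Q p? q?) (sym (isYes≗does q?)))

isYes-true : {P : Set} {p? : Dec P} → P → ⌊ p? ⌋ ≡ true
isYes-true {p? = p?} p = trans (isYes≗does p?) (dec-true p? p)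

isYes-false : {P : Set} {p? : Dec P} → ¬ P → ⌊ p? ⌋ ≡ false
isYes-false {p? = p?} ¬p = trans (isYes≗does p?) (dec-false p? ¬p)

eqFin-refl : ∀ {k} (x : Fin k) → eqFin x x ≡ true
eqFin-refl x = isYes-true refl

eqFin-≢ : ∀ {k} {x y : Fin k} → x ≢ y → eqFin x y ≡ false
eqFin-≢ = isYes-false

module _ {V : Set} (eq : V → V → Bool) (vs : List V) (a : V → V → Bool) where

  δadj-cong : {W : Set} (eq′ : W → W → Bool) (ws : List W) (a′ : W → W → Bool) {u v : V} {u′ v′ : W} →
    eq u v ≡ eq′ u′ v′ →
    (degree vs a u ≡ degree vs a v ⇔ degree ws a′ u′ ≡ degree ws a′ v′) →
    a u v ≡ a′ u′ v′ →
    δadj eq vs a u v ≡ δadj eq′ ws a′ u′ v′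
  δadj-cong eq′ ws a′ {u} {v} {u′} {v′} eq≡ deg⇔ a≡
    rewrite eq≡ | a≡ | isYes-⇔ deg⇔ (degree vs a u ≟ℕ degree vs a v) (degree ws a′ u′ ≟ℕ degree ws a′ v′)
    = refl

  δadj-irrefl : {u v : V} → eq u v ≡ true → δadj eq vs a u v ≡ false
  δadj-irrefl eq≡true rewrite eq≡true = refl

  δadj-nonadjacent : {u v : V} → eq u v ≡ false → a u v ≡ false →
    δadj eq vs a u v ≡ ⌊ degree vs a u ≟ℕ degree vs a v ⌋
  δadj-nonadjacent {u} {v} eq≡false a≡false rewrite eq≡false | a≡false
    with ⌊ degree vs a u ≟ℕ degree vs a v ⌋
  ... | true  = refl
  ... | false = refl

module _ {n m} (a : Fin n → Fin n → Bool) (b : Fin m → Fin m → Bool) where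

  □adj-row : ∀ {x} → a x x ≡ false → ∀ y y′ → □adj a b (x , y) (x , y′) ≡ b y y′
  □adj-row {x} axx≡false y y′ rewrite eqFin-refl x | axx≡false =
    trans (cong (b y y′ ∨_) (∧-zeroʳ (eqFin y y′))) (∨-identityʳ (b y y′))

  □adj-column : ∀ {y} → b y y ≡ false → ∀ x x′ → □adj a b (x , y) (x′ , y) ≡ a x x′
  □adj-column {y} byy≡false x x′ rewrite eqFin-refl y | byy≡false | ∧-zeroʳ (eqFin x x′) = refl

  □adj-off-diagonal : ∀ {x x′ y y′} → x ≢ x′ → y ≢ y′ → □adj a b (x , y) (x′ , y′) ≡ false
  □adj-off-diagonal x≢x′ y≢y′ rewrite eqFin-≢ x≢x′ | eqFin-≢ y≢y′ = refl

deg : ∀ {k} → Graph k → Fin k → ℕ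
deg {k} G = degree (allFin k) (adj G)

δGraphAdj-irrefl : ∀ {k} (G : Graph k) x → δGraphAdj G x x ≡ false
δGraphAdj-irrefl {k} G x = δadj-irrefl eqFin (allFin k) (adj G) (eqFin-refl x)

module _ {n m} (G : Graph n) (H : Graph m) where

  prodDeg≡deg+deg : ∀ x y → prodDeg G H (x , y) ≡ deg G x + deg H y
  prodDeg≡deg+deg x y = begin
    prodDeg G H (x , y)
      ≡⟨ count-twoRectangles (eqFin x) (adj G x) (adj H y) (eqFin y) eqFin∧adj≡false (allFin n) (allFin m) ⟩
    count (eqFin x) (allFin n) * deg H y + deg G x * count (eqFin y) (allFin m)
      ≡⟨ cong₂ (λ s t → s * deg H y + deg G x * t) (count-eqFin-allFin x) (count-eqFin-allFin y) ⟩
    1 * deg H y + deg G x * 1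
      ≡⟨ solve 2 (λ g h → con 1 :* h :+ g :* con 1 := g :+ h) refl (deg G x) (deg H y) ⟩
    deg G x + deg H y ∎
    where
    eqFin∧adj≡false : ∀ x′ → eqFin x x′ ∧ adj G x x′ ≡ false
    eqFin∧adj≡false x′ with x ≟ᶠ x′
    ... | yes refl = irref G x
    ... | no  _    = refl

  prodDeg-row-≡⇔ : ∀ x y y′ → prodDeg G H (x , y) ≡ prodDeg G H (x , y′) ⇔ deg H y ≡ deg H y′
  prodDeg-row-≡⇔ x y y′ = mk⇔
    (λ eq → +-cancelˡ-≡ (deg G x) _ _ (trans (sym (prodDeg≡deg+deg x y)) (trans eq (prodDeg≡deg+deg x y′))))
    (λ eq → trans (prodDeg≡deg+deg x y) (trans (cong (deg G x +_) eq) (sym (prodDeg≡deg+deg x y′))))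

  prodDeg-column-≡⇔ : ∀ x x′ y → prodDeg G H (x , y) ≡ prodDeg G H (x′ , y) ⇔ deg G x ≡ deg G x′
  prodDeg-column-≡⇔ x x′ y = mk⇔
    (λ eq → +-cancelʳ-≡ (deg H y) _ _ (trans (sym (prodDeg≡deg+deg x y)) (trans eq (prodDeg≡deg+deg x′ y))))
    (λ eq → trans (prodDeg≡deg+deg x y) (trans (cong (_+ deg H y) eq) (sym (prodDeg≡deg+deg x′ y))))

  δProdAdj-row : ∀ x y y′ → δProdAdj G H (x , y) (x , y′) ≡ δGraphAdj H y y′
  δProdAdj-row x y y′ = δadj-cong eqPair (allPairs n m) (prodAdj G H) eqFin (allFin m) (adj H) {x , y} {x , y′}
    (cong (_∧ eqFin y y′) (eqFin-refl x)) (prodDeg-row-≡⇔ x y y′) (□adj-row (adj G) (adj H) (irref G x) y y′)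

  δProdAdj-column : ∀ x x′ y → δProdAdj G H (x , y) (x′ , y) ≡ δGraphAdj G x x′
  δProdAdj-column x x′ y = δadj-cong eqPair (allPairs n m) (prodAdj G H) eqFin (allFin n) (adj G) {x , y} {x′ , y}
    (trans (cong (eqFin x x′ ∧_) (eqFin-refl y)) (∧-identityʳ (eqFin x x′)))
    (prodDeg-column-≡⇔ x x′ y) (□adj-column (adj G) (adj H) (irref H y) x x′)

  δProdAdj-off-diagonal : ∀ {x x′ y y′} → x ≢ x′ → y ≢ y′ →
    δProdAdj G H (x , y) (x′ , y′) ≡ ⌊ prodDeg G H (x , y) ≟ℕ prodDeg G H (x′ , y′) ⌋
  δProdAdj-off-diagonal {x} {x′} {y} {y′} x≢x′ y≢y′ =
    δadj-nonadjacent eqPair (allPairs n m) (prodAdj G H) {x , y} {x′ , y′}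
      (cong (_∧ eqFin y y′) (eqFin-≢ x≢x′)) (□adj-off-diagonal (adj G) (adj H) x≢x′ y≢y′)

  OffDiagonalDegreesDistinct : Set
  OffDiagonalDegreesDistinct = ∀ (u₁ v₁ : Fin n) (u₂ v₂ : Fin m) → u₁ ≢ v₁ → u₂ ≢ v₂ →
    prodDeg G H (u₁ , u₂) ≢ prodDeg G H (v₁ , v₂)

  δProdEq⇒offDiagonalDegreesDistinct : δProdEq G H → OffDiagonalDegreesDistinct
  δProdEq⇒offDiagonalDegreesDistinct δ□≡□δ u₁ v₁ u₂ v₂ u₁≢v₁ u₂≢v₂ deg≡ = true≢false (begin
    true                                                 ≡⟨ sym (isYes-true deg≡) ⟩
    ⌊ prodDeg G H (u₁ , u₂) ≟ℕ prodDeg G H (v₁ , v₂) ⌋   ≡⟨ sym (δProdAdj-off-diagonal u₁≢v₁ u₂≢v₂) ⟩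
    δProdAdj G H (u₁ , u₂) (v₁ , v₂)                     ≡⟨ δ□≡□δ (u₁ , u₂) (v₁ , v₂) ⟩
    □adj (δGraphAdj G) (δGraphAdj H) (u₁ , u₂) (v₁ , v₂) ≡⟨ □adj-off-diagonal (δGraphAdj G) (δGraphAdj H) u₁≢v₁ u₂≢v₂ ⟩
    false                                                ∎)
    where
    true≢false : true ≢ false
    true≢false ()

  offDiagonalDegreesDistinct⇒δProdEq : OffDiagonalDegreesDistinct → δProdEq G H
  offDiagonalDegreesDistinct⇒δProdEq distinct (x , y) (x′ , y′) = by-cases (x ≟ᶠ x′) (y ≟ᶠ y′)
    where
    by-cases : Dec (x ≡ x′) → Dec (y ≡ y′) →
      δProdAdj G H (x , y) (x′ , y′) ≡ □adj (δGraphAdj G) (δGraphAdj H) (x , y) (x′ , y′)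
    by-cases (yes refl) _          =
      trans (δProdAdj-row x y y′) (sym (□adj-row (δGraphAdj G) (δGraphAdj H) (δGraphAdj-irrefl G x) y y′))
    by-cases (no _)     (yes refl) =
      trans (δProdAdj-column x x′ y) (sym (□adj-column (δGraphAdj G) (δGraphAdj H) (δGraphAdj-irrefl H y) x x′))
    by-cases (no x≢x′)  (no y≢y′)  = begin
      δProdAdj G H (x , y) (x′ , y′)                     ≡⟨ δProdAdj-off-diagonal x≢x′ y≢y′ ⟩
      ⌊ prodDeg G H (x , y) ≟ℕ prodDeg G H (x′ , y′) ⌋   ≡⟨ isYes-false (distinct x x′ y y′ x≢x′ y≢y′) ⟩
      false                                              ≡⟨ sym (□adj-off-diagonal (δGraphAdj G) (δGraphAdj H) x≢x′ y≢y′) ⟩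
      □adj (δGraphAdj G) (δGraphAdj H) (x , y) (x′ , y′) ∎

mainTheorem2 : ∀ {n m} (G : Graph n) (H : Graph m) →
    δProdEq G H ⇔
      (∀ (u₁ v₁ : Fin n) (u₂ v₂ : Fin m) → u₁ ≢ v₁ → u₂ ≢ v₂ →
        prodDeg G H (u₁ , u₂) ≢ prodDeg G H (v₁ , v₂))
mainTheorem2 G H = mk⇔ (δProdEq⇒offDiagonalDegreesDistinct G H) (offDiagonalDegreesDistinct⇒δProdEq G H)
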